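{- Let $G=(V,E)$ be a finite simple graph and let $k>1$. For any FAT $k$-coloring of $G$ with parameter $\alpha>0$, all coloring classes have the same volume. In particular, each class has volume $2|E|/k$, and therefore $k$ divides $2|E|$.
   Context: The volume of $S\subseteq V$ is $\operatorname{vol} S=\sum_{v\in S}\deg v$. For $v\in V$ and $S\subseteq V$, let $e(v,S)$ denote the number of neighbors of $v$ in $S$. A vertex $k$-coloring of $G$ is a function $c:V\to\{1,\ldots,k\}$ with coloring classes $V_i=c^{ -1}(i)$. It is Fair and Tolerant (FAT) with parameter $\alpha\in[0,1]$ if, with $\beta:=1-(k-1)\alpha$, for every vertex $v$ and every $i$ we have $e(v,V_i)=\alpha\deg v$ if $v\notin V_i$ and $e(v,V_i)=\beta\deg v$ if $v\in V_i$.
   Formalization: The parameter α of the FAT coloring ranges over the rationals in (0,1] rather than over real numbers. -}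

module Defs where

open import Data.Nat using (ℕ; zero; suc; _+_; _<_)
open import Data.Fin using (Fin; zero; suc; toℕ)
open import Data.Bool using (Bool; true; false; if_then_else_)
open import Data.Integer using (+_)
open import Data.Rational using (ℚ; _/_; _*_; _-_; 1ℚ)
open import Relation.Binary.PropositionalEquality using (_≡_)
open import Relation.Nullary using (¬_)
open import Relation.Nullary.Decidable using (⌊_⌋)
open import Data.Fin using (_≟_)

Σ[_] : (n : ℕ) → (Fin n → ℕ) → ℕ
Σ[ zero ] f = 0
Σ[ suc n ] f = f zero + Σ[ n ] (λ i → f (suc i))

𝟙 : Bool → ℕ
𝟙 b = if b then 1 else 0

record Graph (n : ℕ) : Set where
  field
    adj   : Fin n → Fin n → Bool
    sym   : ∀ u v → adj u v ≡ adj v u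
    irrefl : ∀ v → adj v v ≡ false

module _ {n : ℕ} (G : Graph n) where
  open Graph G

  deg : Fin n → ℕ
  deg v = Σ[ n ] (λ u → 𝟙 (adj v u))

  numEdges : ℕ
  numEdges = Σ[ n ] (λ v → Σ[ n ] (λ u → if ⌊ toℕ u Data.Nat.<? toℕ v ⌋ then 𝟙 (adj u v) else 0))

  vol : (Fin n → Bool) → ℕ
  vol S = Σ[ n ] (λ v → if S v then deg v else 0)

  e : Fin n → (Fin n → Bool) → ℕ
  e v S = Σ[ n ] (λ u → if S u then 𝟙 (adj v u) else 0)

  class : {k : ℕ} → (Fin n → Fin k) → Fin k → Fin n → Bool
  class c i v = ⌊ c v ≟ i ⌋

  ℕ→ℚ : ℕ → ℚ
  ℕ→ℚ m = + m / 1

  β : ℕ → ℚ → ℚ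
  β k α = 1ℚ - (ℕ→ℚ (k Data.Nat.∸ 1) * α)

  IsFAT : (k : ℕ) → (Fin n → Fin k) → ℚ → Set
  IsFAT k c α = ∀ (v : Fin n) (i : Fin k) →
    (¬ (c v ≡ i) → ℕ→ℚ (e v (class c i)) ≡ α * ℕ→ℚ (deg v)) ×
    (c v ≡ i → ℕ→ℚ (e v (class c i)) ≡ β k α * ℕ→ℚ (deg v))
    where open import Data.Product using (_×_)

{-# OPTIONS --safe #-}
module Submission where

-- For distinct colours i ≠ j, counting the edges between V_i and V_j from
-- either side gives α vol V_i = e(V_i, V_j) = e(V_j, V_i) = α vol V_j, so
-- α > 0 forces vol V_i = vol V_j.  The classes partition V, hence their
-- volumes add up to the degree sum 2|E|.

open import Defs
open import Data.Nat using (ℕ; _<_; _*_)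
open import Data.Nat.Divisibility using (_∣_)
open import Data.Fin using (Fin)
open import Data.Product using (_×_)
open import Data.Rational using (ℚ; 0ℚ; 1ℚ; _≤_)
open import Relation.Binary.PropositionalEquality using (_≡_)
import Data.Rational as Q

open import Data.Bool using (Bool; true; false; if_then_else_)
open import Data.Empty using (⊥-elim)
open import Data.Fin using (zero; suc; toℕ; _≟_)
open import Data.Fin.Properties using (toℕ-injective)
import Data.Integer as ℤ
import Data.Integer.Properties as ℤ
open import Data.Nat using (zero; suc; _+_; _<?_)
open import Data.Nat.Coprimality as Coprimality using (1-coprimeTo)
open import Data.Nat.Divisibility using (m∣m*n)
open import Data.Nat.Properties
  using (+-0-commutativeMonoid; +-identityʳ; <-asym; ≤-antisym; ≮⇒≥)
open import Algebra.Properties.CommutativeMonoid.Sum +-0-commutativeMonoid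
  using (sum; sum-cong-≗; sum-replicate-zero; ∑-distrib-+; ∑-comm)
open import Data.Product using (_,_; proj₁)
open import Data.Rational using (_/_)
import Data.Rational.Properties as Q
open import Function using (_∘_)
open import Relation.Binary.PropositionalEquality
  using (refl; sym; trans; cong; cong₂; subst; module ≡-Reasoning)
open import Relation.Nullary using (¬_; yes; no)
open import Relation.Nullary.Decidable using (⌊_⌋; ⌊⌋-map′)

Σ≡sum : ∀ n (f : Fin n → ℕ) → Σ[ n ] f ≡ sum f
Σ≡sum zero    f = refl
Σ≡sum (suc n) f = cong (f zero +_) (Σ≡sum n (f ∘ suc))

Σ-cong : ∀ n {f g : Fin n → ℕ} → (∀ i → f i ≡ g i) → Σ[ n ] f ≡ Σ[ n ] g
Σ-cong n {f} {g} f≗g =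
  trans (Σ≡sum n f) (trans (sum-cong-≗ f≗g) (sym (Σ≡sum n g)))

Σ-zero : ∀ n → Σ[ n ] (λ _ → 0) ≡ 0
Σ-zero n = trans (Σ≡sum n _) (sum-replicate-zero n)

Σ-const : ∀ n x → Σ[ n ] (λ _ → x) ≡ n * x
Σ-const zero    x = refl
Σ-const (suc n) x = cong (x +_) (Σ-const n x)

Σ-distrib-+ : ∀ n (f g : Fin n → ℕ) →
  Σ[ n ] (λ i → f i + g i) ≡ Σ[ n ] f + Σ[ n ] g
Σ-distrib-+ n f g = begin
  Σ[ n ] (λ i → f i + g i)  ≡⟨ Σ≡sum n _ ⟩
  sum (λ i → f i + g i)     ≡⟨ ∑-distrib-+ f g ⟩
  sum f + sum g             ≡⟨ sym (cong₂ _+_ (Σ≡sum n f) (Σ≡sum n g)) ⟩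
  Σ[ n ] f + Σ[ n ] g       ∎
  where open ≡-Reasoning

Σ-comm : ∀ m n (f : Fin m → Fin n → ℕ) →
  Σ[ m ] (λ i → Σ[ n ] (f i)) ≡ Σ[ n ] (λ j → Σ[ m ] (λ i → f i j))
Σ-comm m n f = begin
  Σ[ m ] (λ i → Σ[ n ] (f i))            ≡⟨ Σ≡sum² m n f ⟩
  sum (λ i → sum (f i))                  ≡⟨ ∑-comm f ⟩
  sum (λ j → sum (λ i → f i j))          ≡⟨ sym (Σ≡sum² n m (λ j i → f i j)) ⟩
  Σ[ n ] (λ j → Σ[ m ] (λ i → f i j))    ∎
  where
  open ≡-Reasoning
  Σ≡sum² : ∀ m n (f : Fin m → Fin n → ℕ) →
    Σ[ m ] (λ i → Σ[ n ] (f i)) ≡ sum (λ i → sum (f i))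
  Σ≡sum² m n f = trans (Σ≡sum m _) (sum-cong-≗ (λ i → Σ≡sum n (f i)))

Σ-if : ∀ n (b : Bool) (f : Fin n → ℕ) →
  (if b then Σ[ n ] f else 0) ≡ Σ[ n ] (λ i → if b then f i else 0)
Σ-if n true  f = refl
Σ-if n false f = sym (Σ-zero n)

Σ-indicator : ∀ k (x : Fin k) d → Σ[ k ] (λ i → if ⌊ x ≟ i ⌋ then d else 0) ≡ d
Σ-indicator (suc k) zero    d = trans (cong (d +_) (Σ-zero k)) (+-identityʳ d)
Σ-indicator (suc k) (suc x) d = trans
  (Σ-cong k (λ i → cong (λ b → if b then d else 0) (⌊⌋-map′ _ _ (x ≟ i))))
  (Σ-indicator k x d)

ℕ→ℚ-canonical : ∀ m →
  ℤ.+ m / 1 ≡ Q.mkℚ (ℤ.+ m) 0 (Coprimality.sym (1-coprimeTo m))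
ℕ→ℚ-canonical m = Q.normalize-coprime (Coprimality.sym (1-coprimeTo m))

ℕ→ℚ-homo-+ : ∀ a b → ℤ.+ (a + b) / 1 ≡ ℤ.+ a / 1 Q.+ ℤ.+ b / 1
ℕ→ℚ-homo-+ a b rewrite ℕ→ℚ-canonical a | ℕ→ℚ-canonical b =
  cong (_/ 1) (sym (cong₂ ℤ._+_ (ℤ.*-identityʳ (ℤ.+ a)) (ℤ.*-identityʳ (ℤ.+ b))))

ℕ→ℚ-injective : ∀ a b → ℤ.+ a / 1 ≡ ℤ.+ b / 1 → a ≡ b
ℕ→ℚ-injective a b eq = ℤ.+-injective (cong Q.↥_
  (trans (sym (ℕ→ℚ-canonical a)) (trans eq (ℕ→ℚ-canonical b))))

ℕ→ℚ-Σ-scale : ∀ (α : ℚ) n (f g : Fin n → ℕ) →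
  (∀ i → ℤ.+ f i / 1 ≡ α Q.* (ℤ.+ g i / 1)) →
  ℤ.+ Σ[ n ] f / 1 ≡ α Q.* (ℤ.+ Σ[ n ] g / 1)
ℕ→ℚ-Σ-scale α zero    f g f≡αg = sym (Q.*-zeroʳ α)
ℕ→ℚ-Σ-scale α (suc n) f g f≡αg = begin
  ℤ.+ (f zero + Σf′) / 1
    ≡⟨ ℕ→ℚ-homo-+ (f zero) Σf′ ⟩
  ℤ.+ f zero / 1 Q.+ ℤ.+ Σf′ / 1
    ≡⟨ cong₂ Q._+_ (f≡αg zero) (ℕ→ℚ-Σ-scale α n _ _ (f≡αg ∘ suc)) ⟩
  α Q.* (ℤ.+ g zero / 1) Q.+ α Q.* (ℤ.+ Σg′ / 1)
    ≡⟨ sym (Q.*-distribˡ-+ α _ _) ⟩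
  α Q.* (ℤ.+ g zero / 1 Q.+ ℤ.+ Σg′ / 1)
    ≡⟨ cong (α Q.*_) (sym (ℕ→ℚ-homo-+ (g zero) Σg′)) ⟩
  α Q.* (ℤ.+ (g zero + Σg′) / 1)
    ∎
  where
  open ≡-Reasoning
  Σf′ = Σ[ n ] (f ∘ suc)
  Σg′ = Σ[ n ] (g ∘ suc)

*-cancelˡ-≡-pos : ∀ {α x y : ℚ} → 0ℚ Q.< α → α Q.* x ≡ α Q.* y → x ≡ y
*-cancelˡ-≡-pos {α} 0<α αx≡αy = Q.≤-antisym
  (Q.*-cancelˡ-≤-pos α (Q.≤-reflexive αx≡αy))
  (Q.*-cancelˡ-≤-pos α (Q.≤-reflexive (sym αx≡αy)))
  where
  instance
    α-pos : Q.Positive α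
    α-pos = Q.positive 0<α

module _ {n : ℕ} (G : Graph n) where
  open Graph G using (adj; irrefl)

  eBetween : (Fin n → Bool) → (Fin n → Bool) → ℕ
  eBetween S T = Σ[ n ] (λ v → if S v then e G v T else 0)

  eBetween-comm : ∀ S T → eBetween S T ≡ eBetween T S
  eBetween-comm S T = begin
    Σ[ n ] (λ v → if S v then e G v T else 0)
      ≡⟨ Σ-cong n (λ v → Σ-if n (S v) _) ⟩
    Σ[ n ] (λ v → Σ[ n ] (λ u → if S v then adjIn T v u else 0))
      ≡⟨ Σ-comm n n _ ⟩
    Σ[ n ] (λ u → Σ[ n ] (λ v → if S v then adjIn T v u else 0))
      ≡⟨ Σ-cong n (λ u → Σ-cong n (swap u)) ⟩
    Σ[ n ] (λ u → Σ[ n ] (λ v → if T u then adjIn S u v else 0))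
      ≡⟨ sym (Σ-cong n (λ u → Σ-if n (T u) _)) ⟩
    Σ[ n ] (λ u → if T u then e G u S else 0)
      ∎
    where
    open ≡-Reasoning
    adjIn : (Fin n → Bool) → Fin n → Fin n → ℕ
    adjIn X v u = if X u then 𝟙 (adj v u) else 0
    swap : ∀ u v → (if S v then adjIn T v u else 0) ≡ (if T u then adjIn S u v else 0)
    swap u v with S v | T u
    ... | true  | true  = cong 𝟙 (Graph.sym G v u)
    ... | true  | false = refl
    ... | false | true  = refl
    ... | false | false = refl

  backEdge : Fin n → Fin n → ℕ
  backEdge v u = if ⌊ toℕ u <? toℕ v ⌋ then 𝟙 (adj u v) else 0

  adj-split : ∀ v u → 𝟙 (adj v u) ≡ backEdge v u + backEdge u v
  adj-split v u with toℕ u <? toℕ v | toℕ v <? toℕ u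
  ... | yes u<v | yes v<u = ⊥-elim (<-asym u<v v<u)
  ... | yes _   | no _    = trans (cong 𝟙 (Graph.sym G v u)) (sym (+-identityʳ _))
  ... | no _    | yes _   = refl
  ... | no u≮v  | no v≮u with toℕ-injective (≤-antisym (≮⇒≥ v≮u) (≮⇒≥ u≮v))
  ...   | refl = cong 𝟙 (irrefl v)

  handshake : Σ[ n ] (deg G) ≡ 2 * numEdges G
  handshake = begin
    Σ[ n ] (λ v → Σ[ n ] (λ u → 𝟙 (adj v u)))
      ≡⟨ Σ-cong n (λ v → trans (Σ-cong n (adj-split v)) (Σ-distrib-+ n _ _)) ⟩
    Σ[ n ] (λ v → Σ[ n ] (backEdge v) + Σ[ n ] (λ u → backEdge u v))
      ≡⟨ Σ-distrib-+ n _ _ ⟩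
    numEdges G + Σ[ n ] (λ v → Σ[ n ] (λ u → backEdge u v))
      ≡⟨ cong (numEdges G +_) (Σ-comm n n (λ v u → backEdge u v)) ⟩
    numEdges G + numEdges G
      ≡⟨ cong (numEdges G +_) (sym (+-identityʳ _)) ⟩
    2 * numEdges G
      ∎
    where open ≡-Reasoning

  Σ-vol-class : ∀ {k} (c : Fin n → Fin k) →
    Σ[ k ] (vol G ∘ class G c) ≡ Σ[ n ] (deg G)
  Σ-vol-class {k} c = trans
    (Σ-comm k n (λ i v → if class G c i v then deg G v else 0))
    (Σ-cong n (λ v → Σ-indicator k (c v) (deg G v)))

  module _ {k} {c : Fin n → Fin k} {α : ℚ} (fat : IsFAT G k c α) where

    eBetween-class : ∀ {i j} → ¬ i ≡ j →
      ℕ→ℚ G (eBetween (class G c i) (class G c j))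
        ≡ α Q.* ℕ→ℚ G (vol G (class G c i))
    eBetween-class {i} {j} i≢j = ℕ→ℚ-Σ-scale α n _ _ pointwise
      where
      pointwise : ∀ v → ℕ→ℚ G (if class G c i v then e G v (class G c j) else 0)
                      ≡ α Q.* ℕ→ℚ G (if class G c i v then deg G v else 0)
      pointwise v with c v ≟ i
      ... | yes cv≡i = proj₁ (fat v j) (i≢j ∘ trans (sym cv≡i))
      ... | no _     = sym (Q.*-zeroʳ α)

    vol-class-equal : 0ℚ Q.< α →
      ∀ i j → vol G (class G c i) ≡ vol G (class G c j)
    vol-class-equal 0<α i j with i ≟ j
    ... | yes refl = refl
    ... | no i≢j   = ℕ→ℚ-injective _ _ (*-cancelˡ-≡-pos 0<α (begin
      α Q.* ℕ→ℚ G (vol G (class G c i))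
        ≡⟨ sym (eBetween-class i≢j) ⟩
      ℕ→ℚ G (eBetween (class G c i) (class G c j))
        ≡⟨ cong (ℕ→ℚ G) (eBetween-comm _ _) ⟩
      ℕ→ℚ G (eBetween (class G c j) (class G c i))
        ≡⟨ eBetween-class (i≢j ∘ sym) ⟩
      α Q.* ℕ→ℚ G (vol G (class G c j))
        ∎))
      where open ≡-Reasoning

  vol-class-uniform : ∀ {k} (c : Fin n → Fin k) →
    (∀ i j → vol G (class G c i) ≡ vol G (class G c j)) →
    ∀ i → k * vol G (class G c i) ≡ 2 * numEdges G
  vol-class-uniform {k} c equal i = begin
    k * vol G (class G c i)            ≡⟨ sym (Σ-const k _) ⟩
    Σ[ k ] (λ _ → vol G (class G c i)) ≡⟨ Σ-cong k (equal i) ⟩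
    Σ[ k ] (vol G ∘ class G c)         ≡⟨ Σ-vol-class c ⟩
    Σ[ n ] (deg G)                     ≡⟨ handshake ⟩
    2 * numEdges G                     ∎
    where open ≡-Reasoning

proposition2p19 : ∀ {n : ℕ} (G : Graph n) (k : ℕ) → 1 < k →
    (c : Fin n → Fin k) (α : ℚ) → 0ℚ Q.< α → α ≤ 1ℚ → IsFAT G k c α →
    (∀ i j → vol G (class G c i) ≡ vol G (class G c j)) ×
    (∀ i → k * vol G (class G c i) ≡ 2 * numEdges G) ×
    (k ∣ 2 * numEdges G)
proposition2p19 G k@(suc _) _ c α 0<α _ fat = equal , uniform , k∣2m
  where
  equal : ∀ i j → vol G (class G c i) ≡ vol G (class G c j)
  equal = vol-class-equal G fat 0<α
  uniform : ∀ i → k * vol G (class G c i) ≡ 2 * numEdges G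
  uniform = vol-class-uniform G c equal
  k∣2m : k ∣ 2 * numEdges G
  k∣2m = subst (k ∣_) (uniform zero) (m∣m*n _)
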